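{- Let $q\in\mathbb{N}^+$, let $\mathbb{T}_q$ be the $(q+1)$-regular tree, and let $a,b$ be vertices at distance $d$. Then for every $k\in\mathbb{N}$, the number of walks of length $d+2k$ from $a$ to $b$ equals $$\sum_{0\le m\le k}\left(\binom{d+2k}{m}-\binom{d+2k}{m-1}\right)q^m.$$
   Context: A walk of length $n$ from $a$ to $b$ is a sequence of vertices $a=v_0,v_1,\dots,v_n=b$ with consecutive vertices adjacent. Convention $\binom{n}{ -1}=0$. -}

module Defs where

open import Data.Nat using (ℕ; zero; suc; _+_; _*_; _<_)
open import Data.Nat.Combinatorics using (_C_)
open import Data.Fin using (Fin)
open import Data.List using (List; []; _∷_)
open import Data.Sum using (_⊎_)
open import Data.Product using (_×_)
open import Data.Integer as ℤ using (ℤ; +_)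
open import Relation.Nullary using (¬_)

-- The root has q+1 children  node x []  (x : Fin (q+1));
-- the vertex  node x l  has q children  node x (y ∷ l)  (y : Fin q).
-- Hence every vertex has degree q+1 and the graph is a tree.
data Vtx (q : ℕ) : Set where
  root : Vtx q
  node : Fin (suc q) → List (Fin q) → Vtx q

data Child {q : ℕ} : Vtx q → Vtx q → Set where
  rootChild : (x : Fin (suc q)) → Child root (node x [])
  nodeChild : (x : Fin (suc q)) (l : List (Fin q)) (y : Fin q) →
              Child (node x l) (node x (y ∷ l))

Adj : {q : ℕ} → Vtx q → Vtx q → Set
Adj v w = Child v w ⊎ Child w v

data Walk {q : ℕ} : Vtx q → Vtx q → ℕ → Set where
  [] : {a : Vtx q} → Walk a a 0
  _∷_ : {a c b : Vtx q} {n : ℕ} → Adj a c → Walk c b n → Walk a b (suc n)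

Dist : {q : ℕ} → Vtx q → Vtx q → ℕ → Set
Dist a b d = Walk a b d × ((m : ℕ) → m < d → ¬ Walk a b m)

-- binom(n, m-1) with the convention binom(n, -1) = 0.
Cprev : ℕ → ℕ → ℕ
Cprev n zero = 0
Cprev n (suc m) = n C m

sumTo : ℕ → (ℕ → ℤ) → ℤ
sumTo zero f = f 0
sumTo (suc k) f = sumTo k f ℤ.+ f (suc k)

walkFormula : ℕ → ℕ → ℕ → ℤ
walkFormula q d k =
  sumTo k (λ m → ((+ ((d + 2 * k) C m)) ℤ.- (+ Cprev (d + 2 * k) m)) ℤ.* (+ q) ℤ.^ m)

-- Fix b. Across every edge the distance to b changes by exactly one; from a vertex a ≠ b
-- exactly one of the q + 1 neighbours is closer to b, and all neighbours of b are at
-- distance 1. Splitting off the first step, the number W(n, e) of walks of length n from a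
-- vertex at distance e to b therefore satisfies W(n+1, 0) = (q+1) W(n, 1) and
-- W(n+1, e+1) = W(n, e) + q W(n, e+2). The partial sums S(n, k) of the stated formula obey
-- the Pascal-type rule S(n+1, k+1) = S(n, k+1) + q S(n, k), and induction on k and then e
-- gives W(e+2k, e) = S(e+2k, k). Since W(n, e) = 0 for n < e and W(e, e) = 1, the e here is
-- the graph distance.
module Submission where

open import Defs
open import Data.Nat using (ℕ; _+_; _*_; _≤_)
open import Data.Fin using (Fin)
open import Data.Product using (Σ; _×_)
open import Data.Integer using (+_)
open import Function.Bundles using (_↔_)
open import Relation.Binary.PropositionalEquality using (_≡_)

open import Level using (Level)
open import Data.Nat using (zero; suc; pred; _∸_; _<_; s≤s)
open import Data.Nat.Properties
  using ( +-identityʳ; *-zeroʳ; +-∸-assoc; m∸[m∸n]≡n; n∸n≡0; m∸n≤m; m+n∸n≡m; pred[m∸n]≡m∸[1+n]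
        ; m≤n+m; ≤∧≢⇒<; m<n⇒m<1+n; n<1+n; <-cmp; m+1+n≢n)
open import Data.Nat.Combinatorics using (_C_; nCk+nC[k+1]≡[n+1]C[k+1]; nCk≡nC[n∸k])
open import Data.Nat.Tactic.RingSolver as ℕ-Solver using ()
open import Data.Integer as ℤ using (ℤ; 0ℤ; _-_)
open import Data.Integer.Properties using (pos-+; pos-*; +-inverseʳ; *-zeroˡ; *-comm)
open import Data.Integer.Tactic.RingSolver using (solve-∀)
open import Data.Fin as Fin using (punchIn)
open import Data.Fin.Properties using (+↔⊎; *↔×; punchInᵢ≢i; ¬Fin0)
open import Data.List using ([]; _∷_; length)
open import Data.List.Properties using (≡-dec)
open import Data.Product using (_,_; proj₁; proj₂)
open import Data.Product.Function.Dependent.Propositional using (congˡ)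
open import Data.Sum using (_⊎_; inj₁; inj₂)
open import Data.Sum.Function.Propositional using (_⊎-↔_)
open import Function using (_∘_)
open import Function.Bundles using (Inverse; mk↔ₛ′)
open import Function.Properties.Inverse using (↔-refl)
open import Function.Related.Propositional using (module EquationalReasoning; bijection)
open import Function.Related.TypeIsomorphisms using (⊎-assoc; ⊎-comm)
open import Relation.Binary using (tri<; tri≈; tri>)
open import Relation.Binary.PropositionalEquality
  using (refl; sym; trans; cong; cong₂; subst; _≢_; module ≡-Reasoning)
open import Relation.Nullary using (¬_; Dec; yes; no; does; contradiction)
open import Data.Bool using (if_then_else_)
open import Relation.Nullary.Decidable using (map′; _×-dec_; dec-true; dec-false)

module ↔-Reasoning = EquationalReasoning {k = bijection}

private
  variable
    ℓ : Level
    m n e : ℕ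

Σ-Fin-suc-↔ : {A : Fin (suc m) → Set ℓ} →
              Σ (Fin (suc m)) A ↔ (A Fin.zero ⊎ Σ (Fin m) (A ∘ Fin.suc))
Σ-Fin-suc-↔ = mk↔ₛ′
  (λ { (Fin.zero , x) → inj₁ x ; (Fin.suc i , x) → inj₂ (i , x) })
  (λ { (inj₁ x) → Fin.zero , x ; (inj₂ (i , x)) → Fin.suc i , x })
  (λ { (inj₁ x) → refl ; (inj₂ (i , x)) → refl })
  (λ { (Fin.zero , x) → refl ; (Fin.suc i , x) → refl })

Σ-Fin-punchIn-↔ : {A : Fin (suc m) → Set ℓ} (j : Fin (suc m)) →
                  Σ (Fin (suc m)) A ↔ (A j ⊎ Σ (Fin m) (A ∘ punchIn j))
Σ-Fin-punchIn-↔ Fin.zero = Σ-Fin-suc-↔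
Σ-Fin-punchIn-↔ {m = suc m} {ℓ = ℓ} {A = A} (Fin.suc j) = begin
  Σ (Fin (suc (suc m))) A
    ↔⟨ Σ-Fin-suc-↔ ⟩
  (A Fin.zero ⊎ Σ (Fin (suc m)) (A ∘ Fin.suc))
    ↔⟨ ↔-refl ⊎-↔ Σ-Fin-punchIn-↔ j ⟩
  (A Fin.zero ⊎ (A (Fin.suc j) ⊎ Σ (Fin m) (A ∘ Fin.suc ∘ punchIn j)))
    ↔⟨ ⊎-assoc ℓ _ _ _ ⟨
  ((A Fin.zero ⊎ A (Fin.suc j)) ⊎ Σ (Fin m) (A ∘ Fin.suc ∘ punchIn j))
    ↔⟨ ⊎-comm _ _ ⊎-↔ ↔-refl ⟩
  ((A (Fin.suc j) ⊎ A Fin.zero) ⊎ Σ (Fin m) (A ∘ Fin.suc ∘ punchIn j))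
    ↔⟨ ⊎-assoc ℓ _ _ _ ⟩
  (A (Fin.suc j) ⊎ (A Fin.zero ⊎ Σ (Fin m) (A ∘ Fin.suc ∘ punchIn j)))
    ↔⟨ ↔-refl ⊎-↔ Σ-Fin-suc-↔ ⟨
  (A (Fin.suc j) ⊎ Σ (Fin (suc m)) (A ∘ punchIn (Fin.suc j)))
    ∎
  where open ↔-Reasoning

module _ {q : ℕ} where

  parent : Vtx q → Vtx q
  parent root              = root
  parent (node x [])      = root
  parent (node x (_ ∷ l)) = node x l

  depth : Vtx q → ℕ
  depth root       = 0
  depth (node _ l) = suc (length l)

  depth-parent : (v : Vtx q) → depth (parent v) ≡ pred (depth v)
  depth-parent root             = refl
  depth-parent (node x [])      = refl
  depth-parent (node x (_ ∷ _)) = refl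

  depth≡0⇒root : {v : Vtx q} → depth v ≡ 0 → v ≡ root
  depth≡0⇒root {root} _ = refl

  child-parent : {u v : Vtx q} → Child u v → parent v ≡ u
  child-parent (rootChild x)     = refl
  child-parent (nodeChild x l y) = refl

  child-depth : {u v : Vtx q} → Child u v → depth v ≡ suc (depth u)
  child-depth (rootChild x)     = refl
  child-depth (nodeChild x l y) = refl

  parent-child : (v : Vtx q) → v ≢ root → Child (parent v) v
  parent-child root             v≢root = contradiction refl v≢root
  parent-child (node x [])      _      = rootChild x
  parent-child (node x (y ∷ l)) _      = nodeChild x l y

  _≟ᵥ_ : (u v : Vtx q) → Dec (u ≡ v)
  root     ≟ᵥ root       = yes refl
  root     ≟ᵥ node _ _   = no λ ()
  node _ _ ≟ᵥ root       = no λ ()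
  node x l ≟ᵥ node x′ l′ =
    map′ (λ (x≡x′ , l≡l′) → cong₂ node x≡x′ l≡l′) (λ { refl → refl , refl })
         (x Fin.≟ x′ ×-dec ≡-dec Fin._≟_ l l′)

  neighbour : Vtx q → Fin (suc q) → Vtx q
  neighbour root       x           = node x []
  neighbour (node x l) Fin.zero    = parent (node x l)
  neighbour (node x l) (Fin.suc y) = node x (y ∷ l)

  neighbour-adj : (a : Vtx q) (i : Fin (suc q)) → Adj a (neighbour a i)
  neighbour-adj root             x           = inj₁ (rootChild x)
  neighbour-adj (node x l)       (Fin.suc y) = inj₁ (nodeChild x l y)
  neighbour-adj (node x [])      Fin.zero    = inj₂ (rootChild x)
  neighbour-adj (node x (y ∷ l)) Fin.zero    = inj₂ (nodeChild x l y)

  adj-index : {a c : Vtx q} → Adj a c → Fin (suc q)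
  adj-index (inj₁ (rootChild x))     = x
  adj-index (inj₁ (nodeChild x l y)) = Fin.suc y
  adj-index (inj₂ (rootChild x))     = Fin.zero
  adj-index (inj₂ (nodeChild x l y)) = Fin.zero

  neighbour-adj-index : {a c : Vtx q} (e : Adj a c) → neighbour a (adj-index e) ≡ c
  neighbour-adj-index (inj₁ (rootChild x))     = refl
  neighbour-adj-index (inj₁ (nodeChild x l y)) = refl
  neighbour-adj-index (inj₂ (rootChild x))     = refl
  neighbour-adj-index (inj₂ (nodeChild x l y)) = refl

  neighbour-injective : (a : Vtx q) {i j : Fin (suc q)} →
                        neighbour a i ≡ neighbour a j → i ≡ j
  neighbour-injective root                     refl = refl
  neighbour-injective (node x l) {Fin.zero}    {Fin.zero}    _    = refl
  neighbour-injective (node x l) {Fin.suc _}   {Fin.suc _}   refl = refl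
  neighbour-injective (node x l) {Fin.zero}    {Fin.suc _}   eq   =
    contradiction (trans (sym (cong depth eq)) (depth-parent (node x l))) (m+1+n≢n 1)
  neighbour-injective (node x l) {Fin.suc _}   {Fin.zero}    eq   =
    contradiction (trans (cong depth eq) (depth-parent (node x l))) (m+1+n≢n 1)

  first-step : {a b : Vtx q} {n : ℕ} →
               Walk a b (suc n) → Σ (Fin (suc q)) (λ i → Walk (neighbour a i) b n)
  first-step {b = b} {n} (e ∷ w) =
    adj-index e , subst (λ v → Walk v b n) (sym (neighbour-adj-index e)) w

  first-step-neighbour : (a : Vtx q) {b : Vtx q} {n : ℕ} (i : Fin (suc q))
                         (w : Walk (neighbour a i) b n) →
                         first-step (neighbour-adj a i ∷ w) ≡ (i , w)
  first-step-neighbour root             x           w = refl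
  first-step-neighbour (node x l)       (Fin.suc y) w = refl
  first-step-neighbour (node x [])      Fin.zero    w = refl
  first-step-neighbour (node x (y ∷ l)) Fin.zero    w = refl

  neighbour-first-step : {a b : Vtx q} {n : ℕ} (w : Walk a b (suc n)) →
                         neighbour-adj a (proj₁ (first-step w)) ∷ proj₂ (first-step w) ≡ w
  neighbour-first-step (inj₁ (rootChild x) ∷ w)     = refl
  neighbour-first-step (inj₁ (nodeChild x l y) ∷ w) = refl
  neighbour-first-step (inj₂ (rootChild x) ∷ w)     = refl
  neighbour-first-step (inj₂ (nodeChild x l y) ∷ w) = refl

  walk-length-zero : {a c : Vtx q} → Walk a c 0 → a ≡ c
  walk-length-zero [] = refl

  walk-step : (a : Vtx q) {b : Vtx q} {n : ℕ} →
              Walk a b (suc n) ↔ Σ (Fin (suc q)) (λ i → Walk (neighbour a i) b n)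
  walk-step a = mk↔ₛ′ first-step (λ (i , w) → neighbour-adj a i ∷ w)
                      (λ (i , w) → first-step-neighbour a i w) neighbour-first-step

  ancestor : ℕ → Vtx q → Vtx q
  ancestor zero    v = v
  ancestor (suc k) v = parent (ancestor k v)

  depth-ancestor : (k : ℕ) (v : Vtx q) → depth (ancestor k v) ≡ depth v ∸ k
  depth-ancestor zero    v = refl
  depth-ancestor (suc k) v = begin
    depth (parent (ancestor k v)) ≡⟨ depth-parent (ancestor k v) ⟩
    pred (depth (ancestor k v))   ≡⟨ cong pred (depth-ancestor k v) ⟩
    pred (depth v ∸ k)            ≡⟨ pred[m∸n]≡m∸[1+n] (depth v) k ⟩
    depth v ∸ suc k               ∎
    where open ≡-Reasoning

  -- a ≼ b: a lies on the path from the root to b, where it is the unique vertex of its depth.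
  record _≼_ (a b : Vtx q) : Set where
    constructor on-path
    field
      ancestor-at-depth : ancestor (depth b ∸ depth a) b ≡ a

  _≼?_ : (a b : Vtx q) → Dec (a ≼ b)
  a ≼? b = map′ on-path _≼_.ancestor-at-depth (ancestor (depth b ∸ depth a) b ≟ᵥ a)

  ≼-refl : {a : Vtx q} → a ≼ a
  ≼-refl {a} = on-path (cong (λ k → ancestor k a) (n∸n≡0 (depth a)))

  root-≼ : {b : Vtx q} → root ≼ b
  root-≼ {b} = on-path (depth≡0⇒root (trans (depth-ancestor (depth b) b) (n∸n≡0 (depth b))))

  ≼-depth : {a b : Vtx q} → a ≼ b → depth a ≤ depth b
  ≼-depth {a} {b} (on-path eq) =
    subst (_≤ depth b) (trans (sym (depth-ancestor (depth b ∸ depth a) b)) (cong depth eq))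
          (m∸n≤m (depth b) (depth b ∸ depth a))

  ≼-unique : {a c b : Vtx q} → a ≼ b → c ≼ b → depth a ≡ depth c → a ≡ c
  ≼-unique {b = b} (on-path a-eq) (on-path c-eq) eq =
    trans (sym a-eq) (trans (cong (λ d → ancestor (depth b ∸ d) b) eq) c-eq)

  parent-≼ : {a b : Vtx q} → a ≼ b → parent a ≼ b
  parent-≼ {root}         _                  = root-≼
  parent-≼ {node x l} {b} a≼b@(on-path a-eq) = on-path (begin
    ancestor (depth b ∸ depth (parent (node x l))) b
      ≡⟨ cong (λ d → ancestor (depth b ∸ d) b) (depth-parent (node x l)) ⟩
    ancestor (depth b ∸ length l) b
      ≡⟨ cong (λ k → ancestor k b) (+-∸-assoc 1 (≼-depth a≼b)) ⟩
    parent (ancestor (depth b ∸ suc (length l)) b)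
      ≡⟨ cong parent a-eq ⟩
    parent (node x l)
      ∎)
    where open ≡-Reasoning

  child-≼ : {a c b : Vtx q} → Child a c → c ≼ b → a ≼ b
  child-≼ {b = b} ch c≼b = subst (_≼ b) (child-parent ch) (parent-≼ c≼b)

  toward-child : {a b : Vtx q} → a ≼ b → a ≢ b → Σ (Vtx q) (λ c → Child a c × c ≼ b)
  toward-child {a} {b} a≼b@(on-path a-eq) a≢b =
    c , subst (λ u → Child u c) parent-c (parent-child c c≢root) ,
    on-path (cong (λ d → ancestor (depth b ∸ d) b) depth-c)
    where
    a<b : depth a < depth b
    a<b = ≤∧≢⇒< (≼-depth a≼b) λ eq →
      a≢b (trans (sym a-eq)
                 (cong (λ k → ancestor k b) (trans (cong (depth b ∸_) eq) (n∸n≡0 (depth b)))))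

    c : Vtx q
    c = ancestor (depth b ∸ suc (depth a)) b

    depth-c : depth c ≡ suc (depth a)
    depth-c = trans (depth-ancestor (depth b ∸ suc (depth a)) b) (m∸[m∸n]≡n a<b)

    parent-c : parent c ≡ a
    parent-c = trans (cong (λ k → ancestor k b) (sym (+-∸-assoc 1 a<b))) a-eq

    c≢root : c ≢ root
    c≢root c≡root with () ← trans (sym (cong depth c≡root)) depth-c

  -- The clauses split on the list only so that the recursive call on the parent is structural.
  distance : Vtx q → Vtx q → ℕ
  distance root             b = depth b
  distance (node x [])      b =
    if does (node x [] ≼? b) then depth b ∸ depth (node x []) else suc (distance root b)
  distance (node x (y ∷ l)) b =
    if does (node x (y ∷ l) ≼? b) then depth b ∸ depth (node x (y ∷ l))
    else suc (distance (node x l) b)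

module _ {q : ℕ} {b : Vtx q} where

  distance-≼ : {a : Vtx q} → a ≼ b → distance a b ≡ depth b ∸ depth a
  distance-≼ {root}           _   = refl
  distance-≼ {node x []}      a≼b = cong (if_then _ else _) (dec-true (node x [] ≼? b) a≼b)
  distance-≼ {node x (y ∷ l)} a≼b = cong (if_then _ else _) (dec-true (node x (y ∷ l) ≼? b) a≼b)

  distance-⋠ : {a : Vtx q} → ¬ a ≼ b → distance a b ≡ suc (distance (parent a) b)
  distance-⋠ {root}           a⋠b = contradiction root-≼ a⋠b
  distance-⋠ {node x []}      a⋠b = cong (if_then _ else _) (dec-false (node x [] ≼? b) a⋠b)
  distance-⋠ {node x (y ∷ l)} a⋠b = cong (if_then _ else _) (dec-false (node x (y ∷ l) ≼? b) a⋠b)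

  distance-self : distance b b ≡ 0
  distance-self = trans (distance-≼ ≼-refl) (n∸n≡0 (depth b))

  distance-toward : {u v : Vtx q} → Child u v → v ≼ b → distance u b ≡ suc (distance v b)
  distance-toward {u} {v} ch v≼b = begin
    distance u b                  ≡⟨ distance-≼ (child-≼ ch v≼b) ⟩
    depth b ∸ depth u             ≡⟨ +-∸-assoc 1 u<b ⟩
    suc (depth b ∸ suc (depth u)) ≡⟨ cong (λ d → suc (depth b ∸ d)) (sym (child-depth ch)) ⟩
    suc (depth b ∸ depth v)       ≡⟨ cong suc (sym (distance-≼ v≼b)) ⟩
    suc (distance v b)            ∎
    where
    open ≡-Reasoning
    u<b : depth u < depth b
    u<b = subst (_≤ depth b) (child-depth ch) (≼-depth v≼b)

  distance-away : {u v : Vtx q} → Child u v → ¬ v ≼ b → distance v b ≡ suc (distance u b)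
  distance-away ch v⋠b = trans (distance-⋠ v⋠b) (cong (λ w → suc (distance w b)) (child-parent ch))

  adj-distance : {a c : Vtx q} → Adj a c →
                 distance a b ≡ suc (distance c b) ⊎ distance c b ≡ suc (distance a b)
  adj-distance {c = c} (inj₁ ch) with c ≼? b
  ... | yes c≼b = inj₁ (distance-toward ch c≼b)
  ... | no  c⋠b = inj₂ (distance-away ch c⋠b)
  adj-distance {a = a} (inj₂ ch) with a ≼? b
  ... | yes a≼b = inj₂ (distance-toward ch a≼b)
  ... | no  a⋠b = inj₁ (distance-away ch a⋠b)

  private
    suc-asymmetric : {m n : ℕ} → m ≡ suc n → n ≢ suc m
    suc-asymmetric refl eq = m+1+n≢n 1 (sym eq)

  closer-child-≼ : {a c : Vtx q} → Child a c → distance a b ≡ suc (distance c b) → c ≼ b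
  closer-child-≼ {c = c} ch closer with c ≼? b
  ... | yes c≼b = c≼b
  ... | no  c⋠b = contradiction (distance-away ch c⋠b) (suc-asymmetric closer)

  closer-parent-⋠ : {a c : Vtx q} → Child c a → distance a b ≡ suc (distance c b) → ¬ a ≼ b
  closer-parent-⋠ ch closer a≼b = suc-asymmetric closer (distance-toward ch a≼b)

  closer-unique : {a c c′ : Vtx q} → Adj a c → Adj a c′ →
                  distance a b ≡ suc (distance c b) → distance a b ≡ suc (distance c′ b) →
                  c ≡ c′
  closer-unique (inj₁ ch) (inj₁ ch′) cl cl′ =
    ≼-unique (closer-child-≼ ch cl) (closer-child-≼ ch′ cl′)
             (trans (child-depth ch) (sym (child-depth ch′)))
  closer-unique (inj₁ ch) (inj₂ ch′) cl cl′ =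
    contradiction (child-≼ ch (closer-child-≼ ch cl)) (closer-parent-⋠ ch′ cl′)
  closer-unique (inj₂ ch) (inj₁ ch′) cl cl′ =
    contradiction (child-≼ ch′ (closer-child-≼ ch′ cl′)) (closer-parent-⋠ ch cl)
  closer-unique (inj₂ ch) (inj₂ ch′) cl cl′ = trans (sym (child-parent ch)) (child-parent ch′)

  closer-exists : {a : Vtx q} → a ≢ b →
                  Σ (Vtx q) (λ c → Adj a c × distance a b ≡ suc (distance c b))
  closer-exists {a} a≢b with a ≼? b
  ... | yes a≼b with c , ch , c≼b ← toward-child a≼b a≢b = c , inj₁ ch , distance-toward ch c≼b
  ... | no  a⋠b = parent a , inj₂ ch , distance-away ch a⋠b
    where
    ch : Child (parent a) a
    ch = parent-child a λ a≡root → a⋠b (subst (_≼ b) (sym a≡root) root-≼)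

  data NeighbourDistances (a : Vtx q) : ℕ → Set where
    centre     : a ≡ b → (∀ i → distance (neighbour a i) b ≡ 1) → NeighbourDistances a 0
    off-centre : a ≢ b → (j : Fin (suc q)) → distance (neighbour a j) b ≡ e →
                 (∀ i → i ≢ j → distance (neighbour a i) b ≡ suc (suc e)) →
                 NeighbourDistances a (suc e)

  neighbour-distances : (a : Vtx q) → NeighbourDistances a (distance a b)
  neighbour-distances a with a ≟ᵥ b
  ... | yes refl = subst (NeighbourDistances b) (sym distance-self) (centre refl at-one)
    where
    at-one : ∀ i → distance (neighbour b i) b ≡ 1
    at-one i with adj-distance (neighbour-adj b i)
    ... | inj₁ closer  with () ← trans (sym closer) distance-self
    ... | inj₂ farther = trans farther (cong suc distance-self)
  ... | no a≢b with c , adj , closer ← closer-exists a≢b =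
    subst (NeighbourDistances a) (sym closer)
      (off-centre a≢b (adj-index adj) (cong (λ v → distance v b) (neighbour-adj-index adj)) farther)
    where
    farther : ∀ i → i ≢ adj-index adj → distance (neighbour a i) b ≡ suc (suc (distance c b))
    farther i i≢j with adj-distance (neighbour-adj a i)
    ... | inj₁ closer′ = contradiction
      (neighbour-injective a (trans (closer-unique (neighbour-adj a i) adj closer′ closer)
                                    (sym (neighbour-adj-index adj))))
      i≢j
    ... | inj₂ farther′ = trans farther′ (cong suc closer)

Cprev-pascal : (n m : ℕ) → Cprev (suc n) (suc m) ≡ Cprev n m + n C m
Cprev-pascal n zero    = refl
Cprev-pascal n (suc m) = sym (nCk+nC[k+1]≡[n+1]C[k+1] n m)

central-binomial-symmetry : (k : ℕ) → suc (2 * k) C suc k ≡ suc (2 * k) C k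
central-binomial-symmetry k = sym (begin
  suc (2 * k) C k
    ≡⟨ nCk≡nC[n∸k] (subst (k ≤_) (sym 2k+1≡k+1+k) (m≤n+m k (suc k))) ⟩
  suc (2 * k) C (suc (2 * k) ∸ k) ≡⟨ cong (λ n → suc (2 * k) C (n ∸ k)) 2k+1≡k+1+k ⟩
  suc (2 * k) C (suc k + k ∸ k)   ≡⟨ cong (suc (2 * k) C_) (m+n∸n≡m (suc k) k) ⟩
  suc (2 * k) C suc k             ∎)
  where
  open ≡-Reasoning
  2k+1≡k+1+k : suc (2 * k) ≡ suc k + k
  2k+1≡k+1+k = ℕ-Solver.solve (k ∷ [])

module _ (q : ℕ) where

  -- walks n e counts the walks of length n to a fixed vertex from a vertex at distance e from it.
  walks : ℕ → ℕ → ℕ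
  walks zero    zero    = 1
  walks zero    (suc e) = 0
  walks (suc n) zero    = suc q * walks n 1
  walks (suc n) (suc e) = walks n e + q * walks n (suc (suc e))

  walks-below : n < e → walks n e ≡ 0
  walks-below {zero}  {suc e} _         = refl
  walks-below {suc n} {suc e} (s≤s n<e) = begin
    walks n e + q * walks n (suc (suc e))
      ≡⟨ cong₂ (λ x y → x + q * y) (walks-below n<e) (walks-below (m<n⇒m<1+n (m<n⇒m<1+n n<e))) ⟩
    q * 0
      ≡⟨ *-zeroʳ q ⟩
    0 ∎
    where open ≡-Reasoning

  walks-diagonal : (e : ℕ) → walks e e ≡ 1
  walks-diagonal zero    = refl
  walks-diagonal (suc e) = begin
    walks e e + q * walks e (suc (suc e))
      ≡⟨ cong₂ (λ x y → x + q * y) (walks-diagonal e) (walks-below (m<n⇒m<1+n (n<1+n e))) ⟩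
    1 + q * 0
      ≡⟨ cong suc (*-zeroʳ q) ⟩
    1 ∎
    where open ≡-Reasoning

  summand : ℕ → ℕ → ℤ
  summand n m = (+ (n C m) - + Cprev n m) ℤ.* (+ q) ℤ.^ m

  partialSum : ℕ → ℕ → ℤ
  partialSum n k = sumTo k (summand n)

  summand-pascal : (n m : ℕ) → summand (suc n) (suc m) ≡ summand n (suc m) ℤ.+ summand n m ℤ.* + q
  summand-pascal n m = begin
    (+ (suc n C suc m) - + Cprev (suc n) (suc m)) ℤ.* (+ q) ℤ.^ suc m
      ≡⟨ cong₂ (λ x y → (+ x - + y) ℤ.* (+ q) ℤ.^ suc m)
               (sym (nCk+nC[k+1]≡[n+1]C[k+1] n m)) (Cprev-pascal n m) ⟩
    (+ (n C m + n C suc m) - + (Cprev n m + n C m)) ℤ.* (+ q) ℤ.^ suc m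
      ≡⟨ cong₂ (λ x y → (x - y) ℤ.* (+ q) ℤ.^ suc m) (pos-+ (n C m) _) (pos-+ (Cprev n m) _) ⟩
    ((+ (n C m) ℤ.+ + (n C suc m)) - (+ Cprev n m ℤ.+ + (n C m))) ℤ.* (+ q ℤ.* (+ q) ℤ.^ m)
      ≡⟨ regroup (+ (n C m)) (+ (n C suc m)) (+ Cprev n m) ((+ q) ℤ.^ m) (+ q) ⟩
    summand n (suc m) ℤ.+ summand n m ℤ.* + q ∎
    where
    open ≡-Reasoning
    regroup : ∀ (a b c P Q : ℤ) →
              ((a ℤ.+ b) - (c ℤ.+ a)) ℤ.* (Q ℤ.* P) ≡
              (b - a) ℤ.* (Q ℤ.* P) ℤ.+ ((a - c) ℤ.* P) ℤ.* Q
    regroup = solve-∀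

  partialSum-pascal : (n k : ℕ) →
                      partialSum (suc n) (suc k) ≡ partialSum n (suc k) ℤ.+ partialSum n k ℤ.* + q
  partialSum-pascal n zero = begin
    summand n 0 ℤ.+ summand (suc n) 1
      ≡⟨ cong (λ x → summand n 0 ℤ.+ x) (summand-pascal n 0) ⟩
    summand n 0 ℤ.+ (summand n 1 ℤ.+ summand n 0 ℤ.* + q)
      ≡⟨ regroup (summand n 0) (summand n 1) (+ q) ⟩
    (summand n 0 ℤ.+ summand n 1) ℤ.+ summand n 0 ℤ.* + q ∎
    where
    open ≡-Reasoning
    regroup : ∀ (a b Q : ℤ) → a ℤ.+ (b ℤ.+ a ℤ.* Q) ≡ (a ℤ.+ b) ℤ.+ a ℤ.* Q
    regroup = solve-∀
  partialSum-pascal n (suc k) = begin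
    partialSum (suc n) (suc k) ℤ.+ summand (suc n) (suc (suc k))
      ≡⟨ cong₂ ℤ._+_ (partialSum-pascal n k) (summand-pascal n (suc k)) ⟩
    (partialSum n (suc k) ℤ.+ partialSum n k ℤ.* + q) ℤ.+
    (summand n (suc (suc k)) ℤ.+ summand n (suc k) ℤ.* + q)
      ≡⟨ regroup (partialSum n (suc k)) (partialSum n k)
                 (summand n (suc (suc k))) (summand n (suc k)) (+ q) ⟩
    (partialSum n (suc k) ℤ.+ summand n (suc (suc k))) ℤ.+
    (partialSum n k ℤ.+ summand n (suc k)) ℤ.* + q ∎
    where
    open ≡-Reasoning
    regroup : ∀ (s s′ t t′ Q : ℤ) →
              (s ℤ.+ s′ ℤ.* Q) ℤ.+ (t ℤ.+ t′ ℤ.* Q) ≡ (s ℤ.+ t) ℤ.+ (s′ ℤ.+ t′) ℤ.* Q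
    regroup = solve-∀

  summand-central : (k : ℕ) → summand (suc (2 * k)) (suc k) ≡ 0ℤ
  summand-central k = begin
    (+ (N C suc k) - + (N C k)) ℤ.* Q
      ≡⟨ cong (λ x → (+ x - + (N C k)) ℤ.* Q) (central-binomial-symmetry k) ⟩
    (+ (N C k) - + (N C k)) ℤ.* Q
      ≡⟨ cong (ℤ._* Q) (+-inverseʳ (+ (N C k))) ⟩
    0ℤ ℤ.* Q
      ≡⟨ *-zeroˡ Q ⟩
    0ℤ ∎
    where
    open ≡-Reasoning
    N = suc (2 * k)
    Q = (+ q) ℤ.^ suc k

  pos-+-* : (x y : ℕ) → + (x + q * y) ≡ + x ℤ.+ + q ℤ.* + y
  pos-+-* x y = trans (pos-+ x (q * y)) (cong (λ z → + x ℤ.+ z) (pos-* q y))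

  walks-closed-form     : (k e : ℕ) → + walks (e + 2 * k) e ≡ partialSum (e + 2 * k) k
  walks-closed-form-suc : (k e : ℕ) → + walks (2 + e + 2 * k) e ≡ partialSum (2 + e + 2 * k) (suc k)

  walks-closed-form zero    e = cong +_ (trans (cong (λ n → walks n e) (+-identityʳ e)) (walks-diagonal e))
  walks-closed-form (suc k) e =
    subst (λ n → + walks n e ≡ partialSum n (suc k)) (sym (e+2[k+1]≡2+e+2k e k)) (walks-closed-form-suc k e)
    where
    e+2[k+1]≡2+e+2k : ∀ e k → e + 2 * suc k ≡ 2 + e + 2 * k
    e+2[k+1]≡2+e+2k = ℕ-Solver.solve-∀

  -- At distance 0 all q + 1 first steps lead to distance 1; the extra q is matched by the
  -- vanishing central summand, as C(2k+1, k+1) = C(2k+1, k).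
  walks-closed-form-suc k zero = begin
    + (walks N 1 + q * walks N 1)
      ≡⟨ pos-+-* (walks N 1) (walks N 1) ⟩
    + walks N 1 ℤ.+ + q ℤ.* + walks N 1
      ≡⟨ cong (λ s → s ℤ.+ + q ℤ.* s) (walks-closed-form k 1) ⟩
    S ℤ.+ + q ℤ.* S
      ≡⟨ regroup S (+ q) ⟩
    (S ℤ.+ 0ℤ) ℤ.+ S ℤ.* + q
      ≡⟨ cong (λ t → (S ℤ.+ t) ℤ.+ S ℤ.* + q) (sym (summand-central k)) ⟩
    partialSum N (suc k) ℤ.+ S ℤ.* + q
      ≡⟨ sym (partialSum-pascal N k) ⟩
    partialSum (suc N) (suc k) ∎
    where
    open ≡-Reasoning
    N = suc (2 * k)
    S = partialSum N k
    regroup : ∀ (s Q : ℤ) → s ℤ.+ Q ℤ.* s ≡ (s ℤ.+ 0ℤ) ℤ.+ s ℤ.* Q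
    regroup = solve-∀
  walks-closed-form-suc k (suc e) = begin
    + (walks N e + q * walks N (2 + e))
      ≡⟨ pos-+-* (walks N e) (walks N (2 + e)) ⟩
    + walks N e ℤ.+ + q ℤ.* + walks N (2 + e)
      ≡⟨ cong₂ (λ s t → s ℤ.+ + q ℤ.* t) (walks-closed-form-suc k e) (walks-closed-form k (2 + e)) ⟩
    partialSum N (suc k) ℤ.+ + q ℤ.* partialSum N k
      ≡⟨ cong (λ s → partialSum N (suc k) ℤ.+ s) (*-comm (+ q) (partialSum N k)) ⟩
    partialSum N (suc k) ℤ.+ partialSum N k ℤ.* + q
      ≡⟨ sym (partialSum-pascal N k) ⟩
    partialSum (suc N) (suc k) ∎
    where
    open ≡-Reasoning
    N = 2 + e + 2 * k

module _ {q : ℕ} {b : Vtx q} where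

  walk-count    : (n : ℕ) (a : Vtx q) → Walk a b n ↔ Fin (walks q n (distance a b))
  walk-count-at : (n : ℕ) {a : Vtx q} → distance a b ≡ e → Walk a b n ↔ Fin (walks q n e)

  walk-count-at n refl = walk-count n _

  walk-count n a with distance a b | neighbour-distances {b = b} a
  walk-count zero    a | _ | centre refl _ =
    mk↔ₛ′ (λ _ → Fin.zero) (λ _ → []) (λ { Fin.zero → refl ; (Fin.suc ()) }) (λ { [] → refl })
  walk-count zero    a | _ | off-centre a≢b _ _ _ =
    mk↔ₛ′ (λ w → contradiction (walk-length-zero w) a≢b) (λ ()) (λ ())
          (λ w → contradiction (walk-length-zero w) a≢b)
  walk-count (suc n) a | _ | centre refl at-one = begin
    Walk b b (suc n)
      ↔⟨ walk-step b ⟩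
    Σ (Fin (suc q)) (λ i → Walk (neighbour b i) b n)
      ↔⟨ congˡ (λ {i} → walk-count-at n (at-one i)) ⟩
    (Fin (suc q) × Fin (walks q n 1))
      ↔⟨ *↔× ⟨
    Fin (walks q (suc n) 0)
      ∎
    where open ↔-Reasoning
  walk-count (suc n) a | _ | off-centre {e} _ j toward away = begin
    Walk a b (suc n)
      ↔⟨ walk-step a ⟩
    Σ (Fin (suc q)) (λ i → Walk (neighbour a i) b n)
      ↔⟨ Σ-Fin-punchIn-↔ j ⟩
    (Walk (neighbour a j) b n ⊎ Σ (Fin q) (λ i → Walk (neighbour a (punchIn j i)) b n))
      ↔⟨ walk-count-at n toward
           ⊎-↔ congˡ (λ {i} → walk-count-at n (away (punchIn j i) (punchInᵢ≢i j i))) ⟩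
    (Fin (walks q n e) ⊎ (Fin q × Fin (walks q n (2 + e))))
      ↔⟨ ↔-refl ⊎-↔ *↔× ⟨
    (Fin (walks q n e) ⊎ Fin (q * walks q n (2 + e)))
      ↔⟨ +↔⊎ ⟨
    Fin (walks q (suc n) (suc e))
      ∎
    where open ↔-Reasoning

  walk-below-distance : {a : Vtx q} → n < distance a b → ¬ Walk a b n
  walk-below-distance {n} {a} n<d w =
    ¬Fin0 (subst Fin (walks-below q n<d) (Inverse.to (walk-count n a) w))

  geodesic : (a : Vtx q) → Walk a b (distance a b)
  geodesic a = Inverse.from (walk-count (distance a b) a)
                            (subst Fin (sym (walks-diagonal q (distance a b))) Fin.zero)

  Dist⇒distance : {a : Vtx q} {d : ℕ} → Dist a b d → distance a b ≡ d
  Dist⇒distance {a} {d} (w , shortest) with <-cmp (distance a b) d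
  ... | tri< δ<d _ _ = contradiction (geodesic a) (shortest _ δ<d)
  ... | tri≈ _ δ≡d _ = δ≡d
  ... | tri> _ _ d<δ = contradiction w (walk-below-distance d<δ)

proposition6p2 : (q : ℕ) → 1 ≤ q → (a b : Vtx q) (d : ℕ) → Dist a b d →
    (k : ℕ) → Σ ℕ (λ N → (Walk a b (d + 2 * k) ↔ Fin N) × (+ N ≡ walkFormula q d k))
proposition6p2 q _ a b d dist k =
  walks q L d , counted-by-walks , walks-closed-form q k d
  where
  L = d + 2 * k
  counted-by-walks : Walk a b L ↔ Fin (walks q L d)
  counted-by-walks =
    subst (λ e → Walk a b L ↔ Fin (walks q L e)) (Dist⇒distance dist) (walk-count L a)
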